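{- Let $G$ be a $\lambda$-graph and let $Q$ be a query over $G$. Then the spreading $Q^{\#}$ of $Q$ is a sharing equivalence if and only if $[\![n]\!] = [\![m]\!]$ (equality of locally nameless terms) for all nodes $n,m$ of $G$ such that $n \mathrel{Q} m$.
   Context: A pre-$\lambda$-graph is a directed graph with four kinds of nodes: application nodes $\mathrm{App}(n_1,n_2)$, with a left child $n_1$ (direction $\swarrow$) and a right child $n_2$ (direction $\searrow$); abstraction nodes $\mathrm{Abs}(n)$, with one child $n$, its body (direction $\downarrow$); free variable nodes, with no children, each carrying an atom $\mathrm{id}(n)$ from a fixed set of atoms, distinct free variable nodes carrying distinct atoms; bound variable nodes $\mathrm{Var}(l)$, having one binding edge to an abstraction node $l$, its binder. Traces are finite sequences of directions in $\{\swarrow,\downarrow,\searrow\}$; $\epsilon$ is the empty trace and $d\cdot\tau$ denotes the trace $\tau$ extended by one final step $d$. Paths $n \xrightarrow{\tau} m$ are defined inductively (binding edges are never used): $n\xrightarrow{\epsilon} n$; if $n\xrightarrow{\tau}\mathrm{Abs}(m)$ then $n\xrightarrow{\downarrow\cdot\tau} m$; if $n\xrightarrow{\tau}\mathrm{App}(m_1,m_2)$ then $n\xrightarrow{\swarrow\cdot\tau} m_1$ and $n\xrightarrow{\searrow\cdot\tau} m_2$. A root is a node $r$ such that the only path ending at $r$ has empty trace. A path $n\xrightarrow{\tau}$ crosses $m$ if it ends at $m$, and if $n\xrightarrow{\tau}$ crosses $m$ and $n\xrightarrow{d\cdot\tau}$ exists then $n\xrightarrow{d\cdot\tau}$ crosses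 $m$. A node $m$ dominates $n$ if every path from a root to $n$ crosses $m$. A $\lambda$-graph is a pre-$\lambda$-graph that is finite, acyclic ($n\xrightarrow{\tau}n$ implies $\tau=\epsilon$), and in which every bound variable node $\mathrm{Var}(l)$ is dominated by its binder $l$. Locally nameless terms: $t ::= \underline{k} \mid x \mid t\,t \mid \lambda t$ with $k\in\mathbb N$ (bound variables as de Bruijn indices) and $x$ an atom (free variables). For a path $n\xrightarrow{\tau}$ crossing an abstraction node $l$, the index $\mathrm{idx}_l$ is defined by induction on crossing: $\mathrm{idx}_l(n\xrightarrow{\tau}l)=0$; $\mathrm{idx}_l(n\xrightarrow{d\cdot\tau}l')=\mathrm{idx}_l(n\xrightarrow{\tau})+1$ if $l'$ is an abstraction node different from $l$; $\mathrm{idx}_l(n\xrightarrow{d\cdot\tau}m)=\mathrm{idx}_l(n\xrightarrow{\tau})$ otherwise. For a root $r$ the readback is: $[\![r\xrightarrow{\tau}\mathrm{Var}(l)]\!]=\underline{k}$ with $k=\mathrm{idx}_l(r\xrightarrow{\tau})$; $[\![r\xrightarrow{\tau}n]\!]=\mathrm{id}(n)$ for a free variable node $n$; $[\![r\xrightarrow{\tau}\mathrm{Abs}(m)]\!]=\lambda[\![r\xrightarrow{\downarrow\cdot\tau}m]\!]$; $[\![r\xrightarrow{\tau}\mathrm{App}(n_1,n_2)]\!]=[\![r\xrightarrow{\swarrow\cdot\tau}n_1]\!]\,[\![r\xrightarrow{\searrow\cdot\tau}n_2]\!]$; and $[\![r]\!]=[\![r\xrightarrow{\epsilon}r]\!]$.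 Two nodes are homogeneous if both are application nodes, both abstraction nodes, both free variable nodes, or both bound variable nodes; a relation is homogeneous if it only relates homogeneous nodes. Rules on a binary relation $R$ on nodes: ($\swarrow$) $\mathrm{App}(n_1,n_2)\,R\,\mathrm{App}(m_1,m_2)\Rightarrow n_1 R m_1$; ($\searrow$) $\mathrm{App}(n_1,n_2)\,R\,\mathrm{App}(m_1,m_2)\Rightarrow n_2 R m_2$; ($\downarrow$) $\mathrm{Abs}(n)\,R\,\mathrm{Abs}(m)\Rightarrow nRm$; (scoping) $\mathrm{Var}(n)\,R\,\mathrm{Var}(m)\Rightarrow nRm$. A sharing equivalence is an equivalence relation on the nodes that is homogeneous, closed under ($\swarrow$), ($\searrow$), ($\downarrow$), (scoping), and open: if $v,w$ are free variable nodes with $v R w$ then $v=w$. A query over $G$ is a binary relation on the root nodes of $G$. The spreading $R^{\#}$ of $R$ is the smallest relation containing $R$ closed under reflexivity, symmetry, transitivity and the rules ($\swarrow$), ($\searrow$), ($\downarrow$). -}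

module Defs where

open import Data.Nat using (ℕ; zero; suc)
open import Data.Fin using (Fin)
open import Data.List using (List; []; _∷_)
open import Data.Product using (Σ; ∃; _×_; _,_)
open import Relation.Binary.PropositionalEquality using (_≡_; _≢_)
open import Relation.Binary.Structures using (IsEquivalence)
open import Relation.Nullary using (¬_)

data Term (Atom : Set) : Set where
  bvar : ℕ → Term Atom
  fvar : Atom → Term Atom
  app  : Term Atom → Term Atom → Term Atom
  lam  : Term Atom → Term Atom

data Label (Atom : Set) (N : ℕ) : Set where
  App  : Fin N → Fin N → Label Atom N
  Abs  : Fin N → Label Atom N
  FV   : Atom → Label Atom N
  Var  : Fin N → Label Atom N           -- Var(l), binding edge to l

record PreLambdaGraph (Atom : Set) : Set where
  field
    size  : ℕ
    label : Fin size → Label Atom size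
    binder-abs : ∀ {v l} → label v ≡ Var l → ∃ λ b → label l ≡ Abs b
    fv-distinct : ∀ {v w x} → label v ≡ FV x → label w ≡ FV x → v ≡ w

module _ {Atom : Set} (G : PreLambdaGraph Atom) where
  open PreLambdaGraph G

  Node : Set
  Node = Fin size

  data Dir : Set where
    ↙ ↓ ↘ : Dir

  -- traces; (d ∷ τ) is the trace τ extended by one final step d
  Trace : Set
  Trace = List Dir

  -- Path n τ m  :  n --τ--> m   (binding edges never used)
  data Path (n : Node) : Trace → Node → Set where
    ε    : Path n [] n
    down : ∀ {τ a m} → Path n τ a → label a ≡ Abs m → Path n (↓ ∷ τ) m
    left : ∀ {τ a m₁ m₂} → Path n τ a → label a ≡ App m₁ m₂ → Path n (↙ ∷ τ) m₁
    right : ∀ {τ a m₁ m₂} → Path n τ a → label a ≡ App m₁ m₂ → Path n (↘ ∷ τ) m₂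

  IsRoot : Node → Set
  IsRoot r = ∀ {n τ} → Path n τ r → τ ≡ []

  data Crosses (n : Node) : Trace → Node → Set where
    ends : ∀ {τ m} → Path n τ m → Crosses n τ m
    ext  : ∀ {τ m d k} → Crosses n τ m → Path n (d ∷ τ) k → Crosses n (d ∷ τ) m

  Dominates : Node → Node → Set
  Dominates m n = ∀ {r τ} → IsRoot r → Path r τ n → Crosses r τ m

  record IsLambdaGraph : Set where
    field
      -- finiteness holds since nodes are Fin size
      acyclic : ∀ {n τ} → Path n τ n → τ ≡ []
      scoped  : ∀ {v l} → label v ≡ Var l → Dominates l v

  IsAbs : Node → Set
  IsAbs m = ∃ λ b → label m ≡ Abs b

  data Idx (l n : Node) : Trace → ℕ → Set where
    idx-end   : ∀ {τ} → Path n τ l → Idx l n τ 0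
    idx-abs   : ∀ {τ d l' k} → Idx l n τ k → Path n (d ∷ τ) l' →
                IsAbs l' → l' ≢ l → Idx l n (d ∷ τ) (suc k)
    idx-other : ∀ {τ d m k} → Idx l n τ k → Path n (d ∷ τ) m →
                ¬ IsAbs m → Idx l n (d ∷ τ) k

  data Readback (r : Node) : Trace → Node → Term Atom → Set where
    rb-var : ∀ {τ n l k} → Path r τ n → label n ≡ Var l → Idx l r τ k →
             Readback r τ n (bvar k)
    rb-fv  : ∀ {τ n x} → Path r τ n → label n ≡ FV x → Readback r τ n (fvar x)
    rb-abs : ∀ {τ n m t} → Path r τ n → label n ≡ Abs m →
             Readback r (↓ ∷ τ) m t → Readback r τ n (lam t)
    rb-app : ∀ {τ n n₁ n₂ t₁ t₂} → Path r τ n → label n ≡ App n₁ n₂ →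
             Readback r (↙ ∷ τ) n₁ t₁ → Readback r (↘ ∷ τ) n₂ t₂ →
             Readback r τ n (app t₁ t₂)

  ReadbackRoot : Node → Term Atom → Set
  ReadbackRoot r t = Readback r [] r t

  NodeRel : Set₁
  NodeRel = Node → Node → Set

  data Homogeneous : Label Atom size → Label Atom size → Set where
    hApp : ∀ {a b c d} → Homogeneous (App a b) (App c d)
    hAbs : ∀ {a b} → Homogeneous (Abs a) (Abs b)
    hFV  : ∀ {x y} → Homogeneous (FV x) (FV y)
    hVar : ∀ {a b} → Homogeneous (Var a) (Var b)

  record IsSharingEquivalence (R : NodeRel) : Set where
    field
      equivalence : IsEquivalence R
      homogeneous : ∀ {n m} → R n m → Homogeneous (label n) (label m)
      close-↙ : ∀ {n m n₁ n₂ m₁ m₂} → label n ≡ App n₁ n₂ → label m ≡ App m₁ m₂ →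
                R n m → R n₁ m₁
      close-↘ : ∀ {n m n₁ n₂ m₁ m₂} → label n ≡ App n₁ n₂ → label m ≡ App m₁ m₂ →
                R n m → R n₂ m₂
      close-↓ : ∀ {n m n' m'} → label n ≡ Abs n' → label m ≡ Abs m' → R n m → R n' m'
      scoping : ∀ {n m l l'} → label n ≡ Var l → label m ≡ Var l' → R n m → R l l'
      open-fv : ∀ {v w x y} → label v ≡ FV x → label w ≡ FV y → R v w → v ≡ w

  IsQuery : NodeRel → Set
  IsQuery Q = ∀ {n m} → Q n m → IsRoot n × IsRoot m

  data Spread (Q : NodeRel) : NodeRel where
    base  : ∀ {n m} → Q n m → Spread Q n m
    refl' : ∀ {n} → Spread Q n n
    sym'  : ∀ {n m} → Spread Q n m → Spread Q m n
    trans' : ∀ {n m k} → Spread Q n m → Spread Q m k → Spread Q n k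
    sp-↙ : ∀ {n m n₁ n₂ m₁ m₂} → label n ≡ App n₁ n₂ → label m ≡ App m₁ m₂ →
           Spread Q n m → Spread Q n₁ m₁
    sp-↘ : ∀ {n m n₁ n₂ m₁ m₂} → label n ≡ App n₁ n₂ → label m ≡ App m₁ m₂ →
           Spread Q n m → Spread Q n₂ m₂
    sp-↓ : ∀ {n m n' m'} → label n ≡ Abs n' → label m ≡ Abs m' →
           Spread Q n m → Spread Q n' m'

module Submission where

-- (⇐) Holds in every pre-λ-graph.  Below two roots with the same readback, equal traces
-- lead to "aligned" nodes carrying the same subterm; aligned nodes are homogeneous, equal
-- when they are free variables, and aligned bound variables (same de Bruijn index) have
-- their binders at a common trace, hence Q#-related by the downward closure of Q#.
-- Pairs reached along a common trace from Q-related roots ("links") are thus locally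
-- compatible; compatibility is an equivalence and the equivalence closure of links is
-- closed under taking children, so it contains Q#, which is therefore sharing.
--
-- (⇒) Uses that G is a λ-graph.  By acyclicity and finiteness (pigeonhole) paths are
-- shorter than the graph, so every root has a readback, and a sharing equivalence R, being
-- a simulation, never relates a node to a proper descendant.  The latter makes related
-- binders have equal indices along equal traces from related roots, so the readback of r
-- transfers along R to r'.

open import Defs
open import Data.Product using (∃; _×_)
open import Relation.Binary.PropositionalEquality using (_≡_)
open import Function.Bundles using (_⇔_)

open import Data.Nat as ℕ using (ℕ; suc; _≤_; _<_; _+_; s≤s)
open import Data.Nat.Properties using (_≤?_; ≤-trans; ≤-reflexive; ≤⇒≯; ≰⇒>; m≤m+n; +-suc)
open import Data.Fin as Fin using (Fin; toℕ)
open import Data.Fin.Properties using (pigeonhole; _≟_)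
open import Data.List using ([]; _∷_; _++_; length)
open import Data.List.Properties using (length-++-≤ʳ)
open import Data.Product using (_,_; ∃₂; proj₂)
open import Data.Empty using (⊥; ⊥-elim)
open import Relation.Nullary using (Dec; yes; no)
open import Relation.Binary.PropositionalEquality using (refl; sym; trans; cong; subst)
open import Relation.Binary.Structures using (IsEquivalence)
open import Relation.Binary.Construct.Closure.Equivalence as EqClosure using (EqClosure)
open import Relation.Binary.Construct.Closure.ReflexiveTransitive as Star using (_◅_)
open import Relation.Binary.Construct.Closure.Symmetric using (fwd; bwd)
open import Function.Bundles using (mk⇔)

module _ {Atom : Set} (G : PreLambdaGraph Atom) where
  open PreLambdaGraph G

  private variable
    n m n' m' a b r r' l l' x y z : Node G
    τ δ : Trace G
    d : Dir G
    k : ℕ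
    s t : Term Atom
    A B : Label Atom size

  path-det : Path G n τ a → Path G n τ b → a ≡ b
  path-det ε ε = refl
  path-det (down p e) (down q e') with refl ← path-det p q with refl ← trans (sym e) e' = refl
  path-det (left p e) (left q e') with refl ← path-det p q with refl ← trans (sym e) e' = refl
  path-det (right p e) (right q e') with refl ← path-det p q with refl ← trans (sym e) e' = refl

  -- Concatenation of paths (traces are written last step first).
  path-cat : Path G x τ y → Path G y δ z → Path G x (δ ++ τ) z
  path-cat p ε = p
  path-cat p (down q e) = down (path-cat p q) e
  path-cat p (left q e) = left (path-cat p q) e
  path-cat p (right q e) = right (path-cat p q) e

  last-step : Path G n (d ∷ τ) m → ∃ λ a → Path G n τ a × Path G a (d ∷ []) m
  last-step (down p e) = _ , p , down ε e
  last-step (left p e) = _ , p , left ε e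
  last-step (right p e) = _ , p , right ε e

  hom-refl : Homogeneous G A A
  hom-refl {A = App _ _} = hApp
  hom-refl {A = Abs _} = hAbs
  hom-refl {A = FV _} = hFV
  hom-refl {A = Var _} = hVar

  hom-sym : Homogeneous G A B → Homogeneous G B A
  hom-sym hApp = hApp
  hom-sym hAbs = hAbs
  hom-sym hFV = hFV
  hom-sym hVar = hVar

  hom-trans : ∀ {C} → Homogeneous G A B → Homogeneous G B C → Homogeneous G A C
  hom-trans hApp hApp = hApp
  hom-trans hAbs hAbs = hAbs
  hom-trans hFV hFV = hFV
  hom-trans hVar hVar = hVar

  hom-app : Homogeneous G A B → A ≡ App a b → ∃₂ λ a' b' → B ≡ App a' b'
  hom-app hApp refl = _ , _ , refl

  hom-abs : Homogeneous G A B → A ≡ Abs a → ∃ λ b → B ≡ Abs b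
  hom-abs hAbs refl = _ , refl

  hom-fv : ∀ {c} → Homogeneous G A B → A ≡ FV c → ∃ λ c' → B ≡ FV c'
  hom-fv hFV refl = _ , refl

  hom-var : Homogeneous G A B → A ≡ Var a → ∃ λ b → B ≡ Var b
  hom-var hVar refl = _ , refl

  step-hom : Homogeneous G (label n) (label m) → Path G n (d ∷ []) n' → ∃ λ m' → Path G m (d ∷ []) m'
  step-hom h (down ε e) = let (_ , e') = hom-abs h e in _ , down ε e'
  step-hom h (left ε e) = let (_ , _ , e') = hom-app h e in _ , left ε e'
  step-hom h (right ε e) = let (_ , _ , e') = hom-app h e in _ , right ε e'

  record DownwardClosed (R : NodeRel G) : Set where
    field
      close-↙ : ∀ {n m n₁ n₂ m₁ m₂} → label n ≡ App n₁ n₂ → label m ≡ App m₁ m₂ → R n m → R n₁ m₁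
      close-↘ : ∀ {n m n₁ n₂ m₁ m₂} → label n ≡ App n₁ n₂ → label m ≡ App m₁ m₂ → R n m → R n₂ m₂
      close-↓ : ∀ {n m n' m'} → label n ≡ Abs n' → label m ≡ Abs m' → R n m → R n' m'

  spread-closed : (Q : NodeRel G) → DownwardClosed (Spread G Q)
  spread-closed Q = record { close-↙ = sp-↙ ; close-↘ = sp-↘ ; close-↓ = sp-↓ }

  sharing-closed : ∀ {R} → IsSharingEquivalence G R → DownwardClosed R
  sharing-closed SE = record { close-↙ = close-↙ ; close-↘ = close-↘ ; close-↓ = close-↓ }
    where open IsSharingEquivalence SE

  along : ∀ {R} → DownwardClosed R → R x y → Path G x τ a → Path G y τ b → R a b
  along C rxy ε ε = rxy
  along C rxy (down p e) (down q e') = DownwardClosed.close-↓ C e e' (along C rxy p q)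
  along C rxy (left p e) (left q e') = DownwardClosed.close-↙ C e e' (along C rxy p q)
  along C rxy (right p e) (right q e') = DownwardClosed.close-↘ C e e' (along C rxy p q)

  abs? : ∀ a → Dec (IsAbs G a)
  abs? a with label a
  ... | Abs b = yes (b , refl)
  ... | App _ _ = no λ ()
  ... | FV _ = no λ ()
  ... | Var _ = no λ ()

  crossing-index : Crosses G r τ l → ∃ (Idx G l r τ)
  crossing-index (ends p) = _ , idx-end p
  crossing-index {l = l} (ext {k = c} cr p) with c ≟ l | abs? c
  ... | yes refl | _ = _ , idx-end p
  ... | no c≢l | yes ab = let (_ , i) = crossing-index cr in _ , idx-abs i p ab c≢l
  ... | no _ | no ¬ab = let (_ , i) = crossing-index cr in _ , idx-other i p ¬ab

  below-binder : Idx G l r τ k → Path G r τ n → ∃ λ δ → Path G l δ n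
  strictly-below-binder : Idx G l r τ k → Path G r (d ∷ τ) n → ∃ λ δ → Path G l (d ∷ δ) n

  below-binder (idx-end q) p with refl ← path-det q p = _ , ε
  below-binder (idx-abs i _ _ _) p = let (_ , q) = strictly-below-binder i p in _ , q
  below-binder (idx-other i _ _) p = let (_ , q) = strictly-below-binder i p in _ , q

  strictly-below-binder i p =
    let (_ , p₀ , step) = last-step p ; (_ , q) = below-binder i p₀ in _ , path-cat q step

  Unfold : Node G → Trace G → Label Atom size → Term Atom → Set
  Unfold r τ (App n₁ n₂) s =
    ∃₂ λ s₁ s₂ → s ≡ app s₁ s₂ × Readback G r (↙ ∷ τ) n₁ s₁ × Readback G r (↘ ∷ τ) n₂ s₂
  Unfold r τ (Abs n₁) s = ∃ λ s₁ → s ≡ lam s₁ × Readback G r (↓ ∷ τ) n₁ s₁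
  Unfold r τ (FV c) s = s ≡ fvar c
  Unfold r τ (Var l) s = ∃ λ k → s ≡ bvar k × Idx G l r τ k

  unfold : Readback G r τ n s → label n ≡ A → Unfold r τ A s
  unfold (rb-var _ e i) refl rewrite e = _ , refl , i
  unfold (rb-fv _ e) refl rewrite e = refl
  unfold (rb-abs _ e rb) refl rewrite e = _ , refl , rb
  unfold (rb-app _ e rb₁ rb₂) refl rewrite e = _ , _ , refl , rb₁ , rb₂

  Aligned : Node G → Node G → Trace G → Node G → Node G → Set
  Aligned r r' τ n m = ∃ λ s → Readback G r τ n s × Readback G r' τ m s

  aligned : ReadbackRoot G r t → ReadbackRoot G r' t → Path G r τ n → Path G r' τ m → Aligned r r' τ n m
  aligned rb rb' ε ε = _ , rb , rb'
  aligned rb rb' (down p e) (down p' e') with aligned rb rb' p p'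
  ... | _ , ra , ra' with unfold ra e | unfold ra' e'
  ... | s₁ , refl , ra₁ | _ , refl , ra₁' = s₁ , ra₁ , ra₁'
  aligned rb rb' (left p e) (left p' e') with aligned rb rb' p p'
  ... | _ , ra , ra' with unfold ra e | unfold ra' e'
  ... | s₁ , _ , refl , ra₁ , _ | _ , _ , refl , ra₁' , _ = s₁ , ra₁ , ra₁'
  aligned rb rb' (right p e) (right p' e') with aligned rb rb' p p'
  ... | _ , ra , ra' with unfold ra e | unfold ra' e'
  ... | _ , s₂ , refl , _ , ra₂ | _ , _ , refl , _ , ra₂' = s₂ , ra₂ , ra₂'

  aligned-hom : Aligned r r' τ n m → Homogeneous G (label n) (label m)
  aligned-hom (_ , rb-var _ e _ , rb-var _ e' _) rewrite e | e' = hVar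
  aligned-hom (_ , rb-fv _ e , rb-fv _ e') rewrite e | e' = hFV
  aligned-hom (_ , rb-abs _ e _ , rb-abs _ e' _) rewrite e | e' = hAbs
  aligned-hom (_ , rb-app _ e _ _ , rb-app _ e' _ _) rewrite e | e' = hApp

  aligned-abs : Aligned r r' τ n m → IsAbs G n → IsAbs G m
  aligned-abs al (_ , e) = hom-abs (aligned-hom al) e

  common-binder-trace : ReadbackRoot G r t → ReadbackRoot G r' t → IsAbs G l → IsAbs G l' →
                        Idx G l r τ k → Idx G l' r' τ k → ∃ λ ρ → Path G r ρ l × Path G r' ρ l'
  common-binder-trace rb rb' _ _ (idx-end p) (idx-end p') = _ , p , p'
  common-binder-trace rb rb' al al' (idx-abs i _ _ _) (idx-abs i' _ _ _) =
    common-binder-trace rb rb' al al' i i'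
  common-binder-trace rb rb' al al' (idx-other i _ _) (idx-other i' _ _) =
    common-binder-trace rb rb' al al' i i'
  common-binder-trace rb rb' al _ (idx-end p) (idx-other _ p' ¬ab) =
    ⊥-elim (¬ab (aligned-abs (aligned rb rb' p p') al))
  common-binder-trace rb rb' _ _ (idx-abs _ p ab _) (idx-other _ p' ¬ab) =
    ⊥-elim (¬ab (aligned-abs (aligned rb rb' p p') ab))
  common-binder-trace rb rb' _ al' (idx-other _ p ¬ab) (idx-end p') =
    ⊥-elim (¬ab (aligned-abs (aligned rb' rb p' p) al'))
  common-binder-trace rb rb' _ _ (idx-other _ p ¬ab) (idx-abs _ p' ab _) =
    ⊥-elim (¬ab (aligned-abs (aligned rb' rb p' p) ab))

  module FromReadbacks (Q : NodeRel G) where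

    data Link (n m : Node G) : Set where
      link : ∀ {r r' t τ} → Q r r' → ReadbackRoot G r t → ReadbackRoot G r' t →
             Path G r τ n → Path G r' τ m → Link n m

    record Compatible (n m : Node G) : Set where
      field
        homogeneous : Homogeneous G (label n) (label m)
        free-equal : ∀ {c} → label n ≡ FV c → n ≡ m
        binders-spread : ∀ {l l'} → label n ≡ Var l → label m ≡ Var l' → Spread G Q l l'
    open Compatible

    compatible-equivalence : IsEquivalence Compatible
    compatible-equivalence = record { refl = c-refl ; sym = c-sym ; trans = c-trans }
      where
      c-refl : Compatible n n
      c-refl = record
        { homogeneous = hom-refl
        ; free-equal = λ _ → refl
        ; binders-spread = λ e e' → same-binder (trans (sym e) e') }
        where
        same-binder : Var {Atom = Atom} l ≡ Var l' → Spread G Q l l'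
        same-binder refl = refl'

      c-sym : Compatible n m → Compatible m n
      c-sym c = record
        { homogeneous = hom-sym (homogeneous c)
        ; free-equal = λ e → sym (free-equal c (proj₂ (hom-fv (hom-sym (homogeneous c)) e)))
        ; binders-spread = λ e e' → sym' (binders-spread c e' e) }

      c-trans : Compatible n m → Compatible m z → Compatible n z
      c-trans c c' = record
        { homogeneous = hom-trans (homogeneous c) (homogeneous c')
        ; free-equal = λ e → let n≡m = free-equal c e in
            trans n≡m (free-equal c' (subst (λ v → label v ≡ _) n≡m e))
        ; binders-spread = λ e e'' → let (_ , e') = hom-var (homogeneous c) e in
            trans' (binders-spread c e e') (binders-spread c' e' e'') }

    -- Linked nodes are compatible: this is where equal readbacks are used.
    link-compatible : Link n m → Compatible n m
    link-compatible (link q rb rb' p p') = record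
      { homogeneous = aligned-hom al
      ; free-equal = free-equal'
      ; binders-spread = binders-spread' }
      where
      al = aligned rb rb' p p'

      free-equal' : ∀ {c} → label _ ≡ FV c → _ ≡ _
      free-equal' e with al
      ... | _ , ra , ra' with refl ← unfold ra e with ra'
      ... | rb-fv _ e' = fv-distinct e e'

      binders-spread' : ∀ {l l'} → label _ ≡ Var l → label _ ≡ Var l' → Spread G Q l l'
      binders-spread' e e' with al
      ... | _ , ra , ra' with unfold ra e | unfold ra' e'
      ... | _ , refl , i | _ , refl , i' =
        let (_ , pl , pl') = common-binder-trace rb rb' (binder-abs e) (binder-abs e') i i'
        in along (spread-closed Q) (base q) pl pl'

    link-step : Link n m → Path G n (d ∷ []) n' → Path G m (d ∷ []) m' → Link n' m'
    link-step (link q rb rb' p p') s s' = link q rb rb' (path-cat p s) (path-cat p' s')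

    Linked : NodeRel G
    Linked = EqClosure Link

    linked-compatible : Linked n m → Compatible n m
    linked-compatible = EqClosure.fold compatible-equivalence link-compatible

    linked-step : Linked n m → Path G n (d ∷ []) n' → Path G m (d ∷ []) m' → Linked n' m'
    linked-step Star.ε s s' with refl ← path-det s s' = Star.ε
    linked-step (fwd lk ◅ lks) s s' =
      let (_ , t) = step-hom (homogeneous (link-compatible lk)) s
      in fwd (link-step lk s t) ◅ linked-step lks t s'
    linked-step (bwd lk ◅ lks) s s' =
      let (_ , t) = step-hom (hom-sym (homogeneous (link-compatible lk))) s
      in bwd (link-step lk t s) ◅ linked-step lks t s'

    module _ (same-readback : ∀ n m → Q n m → ∃ λ t → ReadbackRoot G n t × ReadbackRoot G m t) where

      spread-linked : Spread G Q n m → Linked n m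
      spread-linked (base {n} {m} q) =
        let (_ , rb , rb') = same-readback n m q in EqClosure.return (link q rb rb' ε ε)
      spread-linked refl' = EqClosure.reflexive Link
      spread-linked (sym' d) = EqClosure.symmetric Link (spread-linked d)
      spread-linked (trans' d d') = EqClosure.transitive Link (spread-linked d) (spread-linked d')
      spread-linked (sp-↙ e e' d) = linked-step (spread-linked d) (left ε e) (left ε e')
      spread-linked (sp-↘ e e' d) = linked-step (spread-linked d) (right ε e) (right ε e')
      spread-linked (sp-↓ e e' d) = linked-step (spread-linked d) (down ε e) (down ε e')

      spread-sharing : IsSharingEquivalence G (Spread G Q)
      spread-sharing = record
        { equivalence = record { refl = refl' ; sym = sym' ; trans = trans' }
        ; homogeneous = λ d → homogeneous (compatible d)
        ; close-↙ = sp-↙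
        ; close-↘ = sp-↘
        ; close-↓ = sp-↓
        ; scoping = λ e e' d → binders-spread (compatible d) e e'
        ; open-fv = λ e _ d → free-equal (compatible d) e }
        where
        compatible : Spread G Q n m → Compatible n m
        compatible d = linked-compatible (spread-linked d)

  Acyclic : Set
  Acyclic = ∀ {n τ} → Path G n τ n → τ ≡ []

  -- The i-th node of a path, counting backwards from its endpoint.
  visit : Path G n τ m → Fin (suc (length τ)) → Node G
  visit {m = m} p Fin.zero = m
  visit {τ = _ ∷ _} p (Fin.suc i) = let (_ , p₀ , _) = last-step p in visit p₀ i

  suffix : (p : Path G n τ m) (i : Fin (suc (length τ))) → ∃ λ δ → Path G (visit p i) δ m
  suffix p Fin.zero = _ , ε
  suffix {τ = _ ∷ _} p (Fin.suc i) =
    let (_ , p₀ , step) = last-step p ; (_ , q) = suffix p₀ i in _ , path-cat q step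

  between : (p : Path G n τ m) (i j : Fin (suc (length τ))) → toℕ i < toℕ j →
            ∃₂ λ d δ → Path G (visit p j) (d ∷ δ) (visit p i)
  between {τ = _ ∷ _} p Fin.zero (Fin.suc j) _ =
    let (_ , p₀ , step) = last-step p ; (_ , q) = suffix p₀ j in _ , _ , path-cat q step
  between {τ = _ ∷ _} p (Fin.suc i) (Fin.suc j) (s≤s i<j) =
    let (_ , p₀ , _) = last-step p in between p₀ i j i<j

  -- In an acyclic graph the nodes of a path are pairwise distinct, so paths are shorter
  -- than the number of nodes (pigeonhole principle).
  path-length< : Acyclic → Path G n τ m → length τ < size
  path-length< {τ = τ} acyclic p with suc (length τ) ≤? size
  ... | yes τ<size = τ<size
  ... | no τ≮size with pigeonhole (≰⇒> τ≮size) (visit p)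
  ... | i , j , i<j , same with between p i j i<j
  ... | d , δ , q with acyclic (subst (Path G (visit p j) (d ∷ δ)) same q)
  ... | ()

  module InLambdaGraph (LG : IsLambdaGraph G) where
    open IsLambdaGraph LG

    -- Every path from a root can be read back; the recursion is on a fuel bounding the
    -- length still available to the path, which is finite by acyclicity.
    readback-exists : IsRoot G r → Path G r τ n → ∃ (Readback G r τ n)
    readback-exists {τ = τ} root p = go size p (m≤m+n size (length τ))
      where
      spend : ∀ f τ → size ≤ suc f + length τ → size ≤ f + suc (length τ)
      spend f τ size≤ = ≤-trans size≤ (≤-reflexive (sym (+-suc f (length τ))))

      go : ∀ {τ n} f → Path G _ τ n → size ≤ f + length τ → ∃ (Readback G _ τ n)
      go ℕ.zero p size≤τ = ⊥-elim (≤⇒≯ size≤τ (path-length< acyclic p))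
      go {τ} {n} (suc f) p size≤ with label n in e
      ... | App _ _ =
        let (_ , rb₁) = go f (left p e) (spend f τ size≤)
            (_ , rb₂) = go f (right p e) (spend f τ size≤)
        in _ , rb-app p e rb₁ rb₂
      ... | Abs _ = let (_ , rb) = go f (down p e) (spend f τ size≤) in _ , rb-abs p e rb
      ... | FV _ = _ , rb-fv p e
      ... | Var _ = let (_ , i) = crossing-index (scoped e root p) in _ , rb-var p e i

    module Sharing {R : NodeRel G} (SE : IsSharingEquivalence G R) where
      open IsSharingEquivalence SE
      open IsEquivalence equivalence using () renaming (sym to R-sym; trans to R-trans)

      related-along : R x y → Path G x τ a → Path G y τ b → R a b
      related-along = along (sharing-closed SE)

      related-abs : R a b → IsAbs G a → IsAbs G b
      related-abs rab (_ , e) = hom-abs (homogeneous rab) e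

      simulate : R x y → Path G x τ z → ∃ (Path G y τ)
      simulate rxy ε = _ , ε
      simulate {τ = _ ∷ _} rxy p =
        let (_ , p₀ , step) = last-step p
            (_ , q) = simulate rxy p₀
            (_ , step') = step-hom (homogeneous (related-along rxy p₀ q)) step
        in _ , path-cat q step'

      -- R never relates a node to a proper descendant: iterating the simulation would
      -- produce arbitrarily long paths.
      no-related-descendant : R x y → Path G x (d ∷ δ) y → ⊥
      no-related-descendant {x = x} {d = d} {δ = δ} rxy p =
        let (_ , _ , _ , q , size≤ , _) = iterate size in ≤⇒≯ size≤ (path-length< acyclic q)
        where
        iterate : ∀ k → ∃ λ τ → ∃₂ λ z w →
                  Path G x τ z × k ≤ length τ × R z w × Path G z (d ∷ δ) w
        iterate ℕ.zero = _ , _ , _ , ε , ℕ.z≤n , rxy , p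
        iterate (suc k) =
          let (τ , _ , _ , q , k≤ , rzw , pzw) = iterate k
              (_ , pw) = simulate rzw pzw
          in _ , _ , _ , path-cat q pzw , s≤s (≤-trans k≤ (length-++-≤ʳ τ {δ})) ,
             related-along rzw pzw pw , pw

      index-agrees : ∀ {k'} → R r r' → R l l' → IsAbs G l →
                     Idx G l r τ k → Idx G l' r' τ k' → k ≡ k'
      index-agrees rr ll al (idx-end p) (idx-end p') = refl
      index-agrees rr ll al (idx-abs i _ _ _) (idx-abs i' _ _ _) = cong suc (index-agrees rr ll al i i')
      index-agrees rr ll al (idx-other i _ _) (idx-other i' _ _) = index-agrees rr ll al i i'
      index-agrees rr ll al (idx-end p) (idx-abs i' p' _ _) =
        let (_ , q) = strictly-below-binder i' p'
        in ⊥-elim (no-related-descendant (R-trans (R-sym ll) (related-along rr p p')) q)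
      index-agrees rr ll al (idx-abs i p _ _) (idx-end p') =
        let (_ , q) = strictly-below-binder i p
        in ⊥-elim (no-related-descendant (R-trans ll (R-sym (related-along rr p p'))) q)
      index-agrees rr ll al (idx-end p) (idx-other _ p' ¬ab) =
        ⊥-elim (¬ab (related-abs (related-along rr p p') al))
      index-agrees rr ll al (idx-abs _ p ab _) (idx-other _ p' ¬ab) =
        ⊥-elim (¬ab (related-abs (related-along rr p p') ab))
      index-agrees rr ll al (idx-other _ p ¬ab) (idx-end p') =
        ⊥-elim (¬ab (related-abs (R-sym (related-along rr p p')) (related-abs ll al)))
      index-agrees rr ll al (idx-other _ p ¬ab) (idx-abs _ p' ab _) =
        ⊥-elim (¬ab (related-abs (R-sym (related-along rr p p')) ab))

      transfer : IsRoot G r' → R r r' → Readback G r τ a s → Path G r' τ b → Readback G r' τ b s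
      transfer root' rr (rb-var p e i) p' =
        let rel = related-along rr p p'
            (_ , e') = hom-var (homogeneous rel) e
            (_ , i') = crossing-index (scoped e' root' p')
            k≡k' = index-agrees rr (scoping e e' rel) (binder-abs e) i i'
        in rb-var p' e' (subst (Idx G _ _ _) (sym k≡k') i')
      transfer root' rr (rb-fv p e) p' =
        let rel = related-along rr p p'
            (_ , e') = hom-fv (homogeneous rel) e
        in rb-fv p' (subst (λ v → label v ≡ FV _) (open-fv e e' rel) e)
      transfer root' rr (rb-abs p e rb) p' =
        let (_ , e') = hom-abs (homogeneous (related-along rr p p')) e
        in rb-abs p' e' (transfer root' rr rb (down p' e'))
      transfer root' rr (rb-app p e rb₁ rb₂) p' =
        let (_ , _ , e') = hom-app (homogeneous (related-along rr p p')) e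
        in rb-app p' e' (transfer root' rr rb₁ (left p' e')) (transfer root' rr rb₂ (right p' e'))

      related-roots-readback : IsRoot G r → IsRoot G r' → R r r' →
                               ∃ λ t → ReadbackRoot G r t × ReadbackRoot G r' t
      related-roots-readback root root' rr =
        let (t , rb) = readback-exists root ε in t , rb , transfer root' rr rb ε

mainTheorem1 : {Atom : Set} (G : PreLambdaGraph Atom) → IsLambdaGraph G →
    (Q : NodeRel G) → IsQuery G Q →
    IsSharingEquivalence G (Spread G Q) ⇔
      (∀ n m → Q n m → ∃ λ t → ReadbackRoot G n t × ReadbackRoot G m t)
mainTheorem1 G LG Q isQuery = mk⇔ readbacks-agree (FromReadbacks.spread-sharing G Q)
  where
  readbacks-agree : IsSharingEquivalence G (Spread G Q) →
                    ∀ n m → Q n m → ∃ λ t → ReadbackRoot G n t × ReadbackRoot G m t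
  readbacks-agree SE n m q =
    let (root-n , root-m) = isQuery q
    in InLambdaGraph.Sharing.related-roots-readback G LG SE root-n root-m (base q)
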